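{- Let $\mathcal{P}$ be any polyomino and let $\mathcal{P}_{K_4}$ be the graph obtained from the graph of $\mathcal{P}$ by replacing each $4$-cycle by a complete graph $K_4$ (i.e. adding both diagonals as edges). Then $\mathcal{P}_{K_4}$ is word-representable.
   Context: A polyomino is a plane figure formed by joining finitely many equal unit squares edge to edge, regarded as a graph whose vertices are the corners of its squares and whose edges are the sides of its squares. A graph $G=(V,E)$ is word-representable if there is a word $w$ over the alphabet $V$ such that for all distinct $x,y\in V$, the letters $x$ and $y$ alternate in $w$ if and only if $\{x,y\}\in E$. -}

module Defs where

open import Data.Integer using (ℤ; _+_; +_)
import Data.Integer.Properties as ℤP
open import Data.Product using (_×_; _,_; ∃; ∃-syntax; Σ-syntax)
open import Data.Product.Properties using (≡-dec)
open import Data.Sum using (_⊎_)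
open import Data.Unit using (⊤)
open import Data.List using (List; []; _∷_; filter)
open import Data.List.Membership.Propositional using (_∈_)
open import Data.List.Relation.Unary.All using (All)
open import Data.List.Relation.Unary.Unique.Propositional using (Unique)
open import Relation.Binary.PropositionalEquality using (_≡_; _≢_)
open import Relation.Binary.Definitions using (DecidableEquality)
open import Relation.Nullary.Decidable using (_⊎-dec_)
open import Function.Bundles using (_⇔_)

-- In a word w, letters x and y alternate iff the subword of w consisting
-- only of occurrences of x and y has no two equal consecutive letters
-- (i.e. it is xyxy... or yxyx...).
NoAdjEq : {A : Set} → List A → Set
NoAdjEq []           = ⊤
NoAdjEq (a ∷ [])     = ⊤
NoAdjEq (a ∷ b ∷ as) = (a ≢ b) × NoAdjEq (b ∷ as)

module _ {A : Set} (_≟_ : DecidableEquality A) where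

  Alternate : List A → A → A → Set
  Alternate w x y = NoAdjEq (filter (λ z → (z ≟ x) ⊎-dec (z ≟ y)) w)

  WordRepresentable : (V : A → Set) (E : A → A → Set) → Set
  WordRepresentable V E =
    ∃[ w ] (All V w
           × (∀ x → V x → x ∈ w)
           × (∀ x y → V x → V y → x ≢ y → (Alternate w x y ⇔ E x y)))

-- Replacing each 4-cycle of a graph by K4: add an edge between the two
-- opposite vertices u, v of every 4-cycle u - a - v - b - u
-- (u ≢ v, a ≢ b; the remaining distinctness follows from looplessness).
K4Closure : {A : Set} → (A → A → Set) → A → A → Set
K4Closure E u v =
  E u v ⊎ (u ≢ v × ∃[ a ] ∃[ b ] (a ≢ b × E u a × E a v × E v b × E b u))

Point : Set
Point = ℤ × ℤ

_≟P_ : DecidableEquality Point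
_≟P_ = ≡-dec ℤP._≟_ ℤP._≟_

-- The cell (i , j) is the unit square [i, i+1] × [j, j+1].
Cell : Set
Cell = ℤ × ℤ

data EdgeAdjacent : Cell → Cell → Set where
  right : ∀ i j → EdgeAdjacent (i , j) (i + + 1 , j)
  left  : ∀ i j → EdgeAdjacent (i + + 1 , j) (i , j)
  up    : ∀ i j → EdgeAdjacent (i , j) (i , j + + 1)
  down  : ∀ i j → EdgeAdjacent (i , j + + 1) (i , j)

data Reach (P : List Cell) : Cell → Cell → Set where
  here : ∀ {c} → Reach P c c
  step : ∀ {c d e} → d ∈ P → EdgeAdjacent c d → Reach P d e → Reach P c e

record Polyomino : Set where
  field
    cells     : List Cell
    unique    : Unique cells
    nonempty  : ∃[ c ] (c ∈ cells)
    connected : ∀ {c d} → c ∈ cells → d ∈ cells → Reach cells c d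

data Corner : Cell → Point → Set where
  c00 : ∀ i j → Corner (i , j) (i , j)
  c10 : ∀ i j → Corner (i , j) (i + + 1 , j)
  c01 : ∀ i j → Corner (i , j) (i , j + + 1)
  c11 : ∀ i j → Corner (i , j) (i + + 1 , j + + 1)

data Side : Cell → Point → Point → Set where
  bottom : ∀ i j → Side (i , j) (i , j) (i + + 1 , j)
  top    : ∀ i j → Side (i , j) (i , j + + 1) (i + + 1 , j + + 1)
  lside  : ∀ i j → Side (i , j) (i , j) (i , j + + 1)
  rside  : ∀ i j → Side (i , j) (i + + 1 , j) (i + + 1 , j + + 1)
  flip   : ∀ {c u v} → Side c u v → Side c v u

PVertex : Polyomino → Point → Set
PVertex P v = ∃[ c ] (c ∈ Polyomino.cells P × Corner c v)

PEdge : Polyomino → Point → Point → Set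
PEdge P u v = ∃[ c ] (c ∈ Polyomino.cells P × Side c u v)

PK4Edge : Polyomino → Point → Point → Set
PK4Edge P = K4Closure (PEdge P)

-- Give each grid point the height  h(x, y) = 2x + [x + y odd].  Along a side of a cell the
-- height changes by ±1 or ±3, across a diagonal of a unit square by exactly ±2.  Orienting every
-- edge of P_{K4} upwards, each arc therefore rises by 1, 2 or 3, and an upward path
-- u ↦ p ↦ q ↦ v with a shortcut u ↦ v consists of four unit sides around one unit square,
-- whose diagonals u q and p v are again edges.
--
-- These three properties alone give word-representability (`Heights.Representation`): call y
-- reachable from x if it lies at least 4 levels above x or is reached by an upward path of
-- at most 3 arcs.  For each ordered pair (a, b) of vertices the word contains four
-- arrangements of the height-sorted vertex list, chosen so that the two ends of every arc
-- always read u v u v, whereas a non-adjacent pair with b reachable from a reads a a b b and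
-- a pair of mutually unreachable vertices reads b a a b.  So exactly the adjacent pairs
-- alternate.
module Submission where

open import Defs

open import Level using (0ℓ)
open import Function using (_∘_; id)
open import Function.Bundles using (mk⇔)
open import Data.Empty using (⊥; ⊥-elim)
open import Data.Unit using (tt)
open import Data.Bool using (Bool; true; false; not)
open import Data.Bool.Properties using (not-involutive)
open import Data.Product using (_×_; _,_; ∃-syntax; Σ; proj₁; proj₂)
import Data.Product as Product
open import Data.Product.Properties using (≡-dec)
open import Data.Sum using (_⊎_; inj₁; inj₂; [_,_])
import Data.Sum as Sum
open import Data.Nat as ℕ using (ℕ; zero; suc; z≤n; s≤s; _<?_)
import Data.Nat.Properties as ℕP
open import Data.Integer as ℤ using (ℤ; +_; -[1+_]; _+_; -_)
import Data.Integer.Properties as ℤP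
open import Data.Integer.Tactic.RingSolver using (solve-∀)
open import Algebra.Bundles using (AbelianGroup)
open import Algebra.Properties.Group (AbelianGroup.group ℤP.+-0-abelianGroup) using (∙-cancelˡ)
open import Data.Fin as Fin using (Fin)
import Data.Fin.Properties as FinP

open import Data.List using (List; []; _∷_; _++_; filter; concatMap; deduplicate)
open import Data.List.Properties using (filter-++; filter-accept; filter-reject; filter-none; concatMap-cong)
open import Data.List.Membership.Propositional using (_∈_; find; lose)
import Data.List.Membership.DecPropositional as DecMembership
open import Data.List.Membership.Propositional.Properties
  using (∈-++⁺ˡ; ∈-filter⁻; ∈-filter⁺; ∈-concatMap⁺; ∈-concatMap⁻; ∈-deduplicate⁺; ∈-deduplicate⁻)
open import Data.List.Relation.Unary.Any using (Any; here; there; any?)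
open import Data.List.Relation.Unary.All as All using (All; []; _∷_)
open import Data.List.Relation.Unary.AllPairs using (AllPairs; []; _∷_)
import Data.List.Relation.Unary.AllPairs.Properties as AllPairsP
open import Data.List.Relation.Unary.Unique.Propositional using (Unique)
open import Data.List.Relation.Unary.Unique.DecPropositional.Properties using (deduplicate-!)
open import Data.List.Relation.Binary.Permutation.Propositional using (_↭_; ↭-sym; ↭⇒↭ₛ)
open import Data.List.Relation.Binary.Permutation.Propositional.Properties using (∈-resp-↭)
import Data.List.Relation.Binary.Permutation.Setoid.Properties as PermS
import Data.List.Sort as Sort
import Data.List.Relation.Unary.Sorted.TotalOrder.Properties as SortedP

open import Relation.Binary.PropositionalEquality
  using (_≡_; _≢_; refl; sym; trans; cong; cong₂; subst; subst₂; setoid; module ≡-Reasoning)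
open import Relation.Binary.Definitions using (DecidableEquality)
open import Relation.Binary.Bundles using (DecTotalOrder)
import Relation.Binary.Construct.On as On
open import Relation.Nullary using (¬_; Dec; yes; no)
open import Relation.Nullary.Decidable using (_⊎-dec_; _×-dec_; _→-dec_; ¬?; map′; from-yes)
open import Relation.Unary using (Pred; Decidable; ∁)
open import Relation.Unary.Properties using (∁?)

module Lists {A : Set} where

  filter-comm : ∀ {P Q : Pred A 0ℓ} (P? : Decidable P) (Q? : Decidable Q) xs →
                filter P? (filter Q? xs) ≡ filter Q? (filter P? xs)
  filter-comm P? Q? [] = refl
  filter-comm P? Q? (x ∷ xs) with Q? x | P? x
  ... | yes q | yes p = begin
    filter P? (x ∷ filter Q? xs)  ≡⟨ filter-accept P? p ⟩
    x ∷ filter P? (filter Q? xs)  ≡⟨ cong (x ∷_) (filter-comm P? Q? xs) ⟩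
    x ∷ filter Q? (filter P? xs)  ≡⟨ filter-accept Q? q ⟨
    filter Q? (x ∷ filter P? xs)  ∎
    where open ≡-Reasoning
  ... | yes q | no ¬p = trans (filter-reject P? ¬p) (filter-comm P? Q? xs)
  ... | no ¬q | yes p = trans (filter-comm P? Q? xs) (sym (filter-reject Q? ¬q))
  ... | no ¬q | no ¬p = filter-comm P? Q? xs

  filter-concatMap : ∀ {b} {B : Set b} {P : Pred A 0ℓ} (P? : Decidable P) (f : B → List A) xs →
                     filter P? (concatMap f xs) ≡ concatMap (filter P? ∘ f) xs
  filter-concatMap P? f [] = refl
  filter-concatMap P? f (x ∷ xs) =
    trans (filter-++ P? (f x) (concatMap f xs)) (cong (filter P? (f x) ++_) (filter-concatMap P? f xs))

  NoAdjEq-++ˡ : ∀ (xs : List A) {ys} → NoAdjEq (xs ++ ys) → NoAdjEq xs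
  NoAdjEq-++ˡ [] h = tt
  NoAdjEq-++ˡ (x ∷ []) h = tt
  NoAdjEq-++ˡ (x ∷ y ∷ xs) (x≢y , h) = x≢y , NoAdjEq-++ˡ (y ∷ xs) h

  NoAdjEq-++ʳ : ∀ (xs : List A) {ys} → NoAdjEq (xs ++ ys) → NoAdjEq ys
  NoAdjEq-++ʳ [] h = h
  NoAdjEq-++ʳ (x ∷ []) {[]} h = tt
  NoAdjEq-++ʳ (x ∷ []) {y ∷ ys} (_ , h) = h
  NoAdjEq-++ʳ (x ∷ y ∷ xs) (_ , h) = NoAdjEq-++ʳ (y ∷ xs) h

  NoAdjEq-concatMap : ∀ {B : Set} (f : B → List A) {xs a} → a ∈ xs → NoAdjEq (concatMap f xs) → NoAdjEq (f a)
  NoAdjEq-concatMap f {x ∷ xs} (here refl) h = NoAdjEq-++ˡ (f x) h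
  NoAdjEq-concatMap f {x ∷ xs} (there a∈) h = NoAdjEq-concatMap f a∈ (NoAdjEq-++ʳ (f x) h)

  data Repeats (u v : A) : List A → Set where
    []   : Repeats u v []
    uv∷_ : ∀ {xs} → Repeats u v xs → Repeats u v (u ∷ v ∷ xs)

  Repeats-++ : ∀ {u v xs ys} → Repeats u v xs → Repeats u v ys → Repeats u v (xs ++ ys)
  Repeats-++ [] r = r
  Repeats-++ (uv∷ r) r′ = uv∷ Repeats-++ r r′

  Repeats-concatMap : ∀ {B : Set} {u v} (f : B → List A) xs → (∀ a → Repeats u v (f a)) →
                      Repeats u v (concatMap f xs)
  Repeats-concatMap f [] r = []
  Repeats-concatMap f (x ∷ xs) r = Repeats-++ (r x) (Repeats-concatMap f xs r)

  Repeats⇒NoAdjEq : ∀ {u v xs} → u ≢ v → Repeats u v xs → NoAdjEq xs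
  Repeats⇒NoAdjEq u≢v [] = tt
  Repeats⇒NoAdjEq {u} {v} u≢v (uv∷ r) = u≢v , v∷ r
    where
    v∷ : ∀ {ys} → Repeats u v ys → NoAdjEq (v ∷ ys)
    v∷ [] = tt
    v∷ (uv∷ r′) = u≢v ∘ sym , Repeats⇒NoAdjEq u≢v (uv∷ r′)

  module Restriction (_≟_ : DecidableEquality A) where

    pair? : ∀ x y → Decidable (λ z → z ≡ x ⊎ z ≡ y)
    pair? x y z = (z ≟ x) ⊎-dec (z ≟ y)

    filter-only : ∀ {Q : Pred A 0ℓ} (Q? : Decidable Q) {y zs} → Q y → (∀ {z} → z ∈ zs → Q z → z ≡ y) →
                  y ∈ zs → Unique zs → filter Q? zs ≡ y ∷ []
    filter-only Q? qy only (here refl) (y∉ ∷ _) =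
      trans (filter-accept Q? qy)
            (cong (_ ∷_) (filter-none Q? (All.tabulate λ z∈ qz → All.lookup y∉ z∈ (sym (only (there z∈) qz)))))
    filter-only Q? qy only (there y∈) (z∉ ∷ u) =
      trans (filter-reject Q? (λ qz → All.lookup z∉ y∈ (only (here refl) qz)))
            (filter-only Q? qy (only ∘ there) y∈ u)

    restrict-two : ∀ {x y zs} → x ≢ y → x ∈ zs → y ∈ zs → Unique zs →
                   filter (pair? x y) zs ≡ x ∷ y ∷ [] ⊎ filter (pair? x y) zs ≡ y ∷ x ∷ []
    restrict-two x≢y (here refl) (here refl) _ = ⊥-elim (x≢y refl)
    restrict-two {x} {y} x≢y (here refl) (there y∈) (x∉ ∷ u) =
      inj₁ (trans (filter-accept (pair? x y) (inj₁ refl))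
                  (cong (x ∷_) (filter-only (pair? x y) (inj₂ refl) only-y y∈ u)))
      where
      only-y : ∀ {z} → z ∈ _ → z ≡ x ⊎ z ≡ y → z ≡ y
      only-y z∈ = [ (λ z≡x → ⊥-elim (All.lookup x∉ z∈ (sym z≡x))) , id ]
    restrict-two {x} {y} x≢y (there x∈) (here refl) (y∉ ∷ u) =
      inj₂ (trans (filter-accept (pair? x y) (inj₂ refl))
                  (cong (y ∷_) (filter-only (pair? x y) (inj₁ refl) only-x x∈ u)))
      where
      only-x : ∀ {z} → z ∈ _ → z ≡ x ⊎ z ≡ y → z ≡ x
      only-x z∈ = [ id , (λ z≡y → ⊥-elim (All.lookup y∉ z∈ (sym z≡y))) ]
    restrict-two {x} {y} x≢y (there x∈) (there y∈) (z∉ ∷ u) =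
      Sum.map (trans skip) (trans skip) (restrict-two x≢y x∈ y∈ u)
      where
      skip = filter-reject (pair? x y) [ All.lookup z∉ x∈ , All.lookup z∉ y∈ ]

  DecSubset : Set₁
  DecSubset = Σ (Pred A 0ℓ) Decidable

  complement : DecSubset → DecSubset
  complement (S , S?) = ∁ S , ∁? S?

  -- Unlike
  -- `filter`, `select` computes on two-element lists to visible `keep`s, so the case analyses
  -- below can match on the decisions directly; it agrees with `filter` (`select≡filter`).
  keep : ∀ {P : Set} → Dec P → A → List A
  keep (yes _) a = a ∷ []
  keep (no _)  a = []

  select : DecSubset → List A → List A
  select S xs = concatMap (λ x → keep (proj₂ S x) x) xs

  -- On a two-element list, `select S (u ∷ v ∷ [])` unfolds to `keep₂ u v (S? u) (S? v)`.
  keep₂ : ∀ {P Q : Set} → A → A → Dec P → Dec Q → List A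
  keep₂ u v p q = keep p u ++ (keep q v ++ [])

  select-one : ∀ (S : DecSubset) {x y zs} → zs ≡ x ∷ y ∷ [] ⊎ zs ≡ y ∷ x ∷ [] →
               proj₁ S x → ¬ proj₁ S y → select S zs ≡ x ∷ []
  select-one (S , S?) {x} {y} (inj₁ refl) sx ¬sy = only-first (S? x) (S? y) sx ¬sy
    where
    only-first : ∀ {P Q : Set} (p : Dec P) (q : Dec Q) → P → ¬ Q → keep₂ x y p q ≡ x ∷ []
    only-first (yes _) (no _)  _  _  = refl
    only-first (no ¬p) _       p  _  = ⊥-elim (¬p p)
    only-first _       (yes q) _  ¬q = ⊥-elim (¬q q)
  select-one (S , S?) {x} {y} (inj₂ refl) sx ¬sy = only-second (S? y) (S? x) ¬sy sx
    where
    only-second : ∀ {P Q : Set} (p : Dec P) (q : Dec Q) → ¬ P → Q → keep₂ y x p q ≡ x ∷ []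
    only-second (no _)  (yes _) _  _ = refl
    only-second (yes p) _       ¬p _ = ⊥-elim (¬p p)
    only-second _       (no ¬q) _  q = ⊥-elim (¬q q)

  select≡filter : ∀ S xs → select S xs ≡ filter (proj₂ S) xs
  select≡filter S [] = refl
  select≡filter (S , S?) (x ∷ xs) with S? x
  ... | yes _ = cong (x ∷_) (select≡filter (S , S?) xs)
  ... | no _  = select≡filter (S , S?) xs

  arrange : List DecSubset → List A → List A
  arrange Ss xs = concatMap (λ S → select S xs) Ss

  filter-arrange : ∀ {Q : Pred A 0ℓ} (Q? : Decidable Q) Ss xs → filter Q? (arrange Ss xs) ≡ arrange Ss (filter Q? xs)
  filter-arrange Q? Ss xs = trans (filter-concatMap Q? _ Ss) (concatMap-cong commute Ss)
    where
    commute : ∀ S → filter Q? (select S xs) ≡ select S (filter Q? xs)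
    commute S = begin
      filter Q? (select S xs)          ≡⟨ cong (filter Q?) (select≡filter S xs) ⟩
      filter Q? (filter (proj₂ S) xs)  ≡⟨ filter-comm Q? (proj₂ S) xs ⟩
      filter (proj₂ S) (filter Q? xs)  ≡⟨ select≡filter S (filter Q? xs) ⟨
      select S (filter Q? xs)          ∎
      where open ≡-Reasoning

  arrange-⊆ : ∀ Ss {xs z} → z ∈ arrange Ss xs → z ∈ xs
  arrange-⊆ Ss {xs} z∈ with find (∈-concatMap⁻ (λ S → select S xs) {xs = Ss} z∈)
  ... | S , _ , z∈S = proj₁ (∈-filter⁻ (proj₂ S) (subst (_ ∈_) (select≡filter S xs) z∈S))

open Lists

module SortBy {A : Set} (κ : A → ℤ) where

  private
    byKey = On.decTotalOrder ℤP.≤-decTotalOrder κ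

  open Sort byKey public using (sort; sort-↭)

  sort-sorted : ∀ xs → AllPairs (λ a b → κ a ℤ.≤ κ b) (sort xs)
  sort-sorted xs = SortedP.Sorted⇒AllPairs (DecTotalOrder.totalOrder byKey) (Sort.sort-↗ byKey xs)

unique-↭ : ∀ {A : Set} {xs ys : List A} → xs ↭ ys → Unique xs → Unique ys
unique-↭ {A} p = PermS.Unique-resp-↭ (setoid A) (↭⇒↭ₛ p)

representable-resp : ∀ {A : Set} (_≟_ : DecidableEquality A) {V V′ : A → Set} {E : A → A → Set} →
                     (∀ {x} → V x → V′ x) → (∀ {x} → V′ x → V x) →
                     WordRepresentable _≟_ V E → WordRepresentable _≟_ V′ E
representable-resp _≟_ V⇒V′ V′⇒V (w , letters , occurs , alternation) =
  w , All.map V⇒V′ letters , (λ x → occurs x ∘ V′⇒V) , λ x y vx vy → alternation x y (V′⇒V vx) (V′⇒V vy)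

module Heights {A : Set} (κ : A → ℤ) where

  record _≼[_]_ (a : A) (n : ℕ) (b : A) : Set where
    constructor rises
    field gap : κ a + + n ℤ.≤ κ b
  open _≼[_]_ public

  ≼-refl : ∀ {a} → a ≼[ 0 ] a
  ≼-refl {a} = rises (ℤP.≤-reflexive (ℤP.+-identityʳ (κ a)))

  ≼-trans : ∀ {a b c m n} → a ≼[ m ] b → b ≼[ n ] c → a ≼[ m ℕ.+ n ] c
  ≼-trans {a} {b} {c} {m} {n} (rises p) (rises q) = rises (begin
    κ a + (+ m + + n)  ≡⟨ ℤP.+-assoc (κ a) (+ m) (+ n) ⟨
    κ a + + m + + n    ≤⟨ ℤP.+-monoˡ-≤ (+ n) p ⟩
    κ b + + n          ≤⟨ q ⟩
    κ c                ∎)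
    where open ℤP.≤-Reasoning

  ≼-weaken : ∀ {a b m n} → m ℕ.≤ n → a ≼[ n ] b → a ≼[ m ] b
  ≼-weaken {a} m≤n (rises p) = rises (ℤP.≤-trans (ℤP.+-monoʳ-≤ (κ a) (ℤ.+≤+ m≤n)) p)

  ≼-bound : ∀ {a b n m} → a ≼[ n ] b → κ b ℤ.≤ κ a + + m → n ℕ.≤ m
  ≼-bound {a} {b} {n} {m} (rises p) q =
    ℤP.drop‿+≤+ (subst₂ ℤ._≤_ (cancel (κ a) (+ n)) (cancel (κ a) (+ m)) shifted)
    where
    cancel : ∀ i k → - i + (i + k) ≡ k
    cancel = solve-∀
    shifted : - κ a + (κ a + + n) ℤ.≤ - κ a + (κ a + + m)
    shifted = ℤP.+-monoʳ-≤ (- κ a) (ℤP.≤-trans p q)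

  ≼-below : ∀ {a b n} → a ≼[ suc n ] b → ¬ κ b ℤ.≤ κ a
  ≼-below {a} h κb≤κa with ≼-bound {m = 0} h (subst (_ ℤ.≤_) (sym (ℤP.+-identityʳ (κ a))) κb≤κa)
  ... | ()

  ≼-asym : ∀ {a b m n} → a ≼[ suc m ] b → ¬ b ≼[ n ] a
  ≼-asym forth back = ≼-below (≼-trans forth back) ℤP.≤-refl

  _≼[_]?_ : ∀ a n b → Dec (a ≼[ n ] b)
  a ≼[ n ]? b = map′ rises gap (κ a + + n ℤP.≤? κ b)

  Arc : (A → A → Set) → A → A → Set
  Arc E u v = E u v × u ≼[ 1 ] v

  module Representation
    (_≟_ : DecidableEquality A)
    (L : List A) (L-unique : Unique L) (L-sorted : AllPairs (λ a b → κ a ℤ.≤ κ b) L)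
    (E : A → A → Set) (E? : ∀ u v → Dec (E u v))
    (E-sym : ∀ {u v} → E u v → E v u) (E⊆L : ∀ {u v} → E u v → u ∈ L)
    (E-oriented : ∀ {u v} → E u v → u ≼[ 1 ] v ⊎ v ≼[ 1 ] u)
    (arc-short : ∀ {u v} → Arc E u v → κ v ℤ.≤ κ u + + 3)
    (chords : ∀ {u p q v} → Arc E u p → Arc E p q → Arc E q v → Arc E u v → E u q × E p v)
    where

    open Restriction _≟_

    _↦_ : A → A → Set
    _↦_ = Arc E

    data Chain : ℕ → A → A → Set where
      []  : ∀ {a} → Chain 0 a a
      _∷_ : ∀ {n a b c} → a ↦ b → Chain n b c → Chain (suc n) a c

    chain-rise : ∀ {n a c} → Chain n a c → a ≼[ n ] c
    chain-rise [] = ≼-refl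
    chain-rise (arc ∷ ch) = ≼-trans (proj₂ arc) (chain-rise ch)

    chain-snoc : ∀ {n a b c} → Chain n a b → b ↦ c → Chain (suc n) a c
    chain-snoc [] arc = arc ∷ []
    chain-snoc (arc′ ∷ ch) arc = arc′ ∷ chain-snoc ch arc

    chain? : ∀ n a c → Dec (Chain n a c)
    chain? zero a c = map′ (λ { refl → [] }) (λ { [] → refl }) (a ≟ c)
    chain? (suc n) a c =
      map′ first-step last-steps (any? (λ b → (E? a b ×-dec a ≼[ 1 ]? b) ×-dec chain? n b c) L)
      where
      first-step : Any (λ b → a ↦ b × Chain n b c) L → Chain (suc n) a c
      first-step h = let (_ , _ , arc , ch) = find h in arc ∷ ch
      last-steps : Chain (suc n) a c → Any (λ b → a ↦ b × Chain n b c) L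
      last-steps (arc ∷ ch) = lose (E⊆L (E-sym (proj₁ arc))) (arc , ch)

    -- Bounded reachability: y is far above x, or reached from x by a chain of fewer than 4 arcs.
    -- As arcs rise by at most 3, within the span of an arc this is plain reachability.
    _⇝_ : A → A → Set
    x ⇝ y = x ≼[ 4 ] y ⊎ ∃[ n ] (n ℕ.< 4 × Chain n x y)

    _⇝?_ : ∀ x y → Dec (x ⇝ y)
    x ⇝? y = x ≼[ 4 ]? y ⊎-dec ℕP.anyUpTo? (λ n → chain? n x y) 4

    ⇝-refl : ∀ {x} → x ⇝ x
    ⇝-refl = inj₂ (0 , s≤s z≤n , [])

    ⇝-rise : ∀ {x y} → x ⇝ y → x ≼[ 0 ] y
    ⇝-rise (inj₁ far) = ≼-weaken z≤n far
    ⇝-rise (inj₂ (_ , _ , ch)) = ≼-weaken z≤n (chain-rise ch)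

    -- Every chain witnesses reachability: a chain of 4 or more arcs rises at least 4.
    chain⇒⇝ : ∀ {n x y} → Chain n x y → x ⇝ y
    chain⇒⇝ {n} ch with n <? 4
    ... | yes n<4 = inj₂ (n , n<4 , ch)
    ... | no n≮4 = inj₁ (≼-weaken (ℕP.≮⇒≥ n≮4) (chain-rise ch))

    ⇝-arcˡ : ∀ {u v a} → u ↦ v → v ⇝ a → u ⇝ a
    ⇝-arcˡ arc (inj₁ far) = inj₁ (≼-weaken (ℕP.n≤1+n 4) (≼-trans (proj₂ arc) far))
    ⇝-arcˡ arc (inj₂ (_ , _ , ch)) = chain⇒⇝ (arc ∷ ch)

    ⇝-arcʳ : ∀ {b u v} → b ⇝ u → u ↦ v → b ⇝ v
    ⇝-arcʳ (inj₁ far) arc = inj₁ (≼-weaken (ℕP.m≤m+n 4 1) (≼-trans far (proj₂ arc)))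
    ⇝-arcʳ (inj₂ (_ , _ , ch)) arc = chain⇒⇝ (chain-snoc ch arc)

    ⇝-antisym : ∀ {x y} → x ⇝ y → y ⇝ x → x ≡ y
    ⇝-antisym (inj₁ far) back = ⊥-elim (≼-asym far (⇝-rise back))
    ⇝-antisym (inj₂ (_ , _ , [])) back = refl
    ⇝-antisym (inj₂ (_ , _ , arc ∷ ch)) back = ⊥-elim (≼-asym (chain-rise (arc ∷ ch)) (⇝-rise back))

    -- Two distinct vertices on a walk of at most 3 arcs spanned by an arc are adjacent:
    -- either they are consecutive, or the walk has a shortcut and `chords` applies.  The last
    -- clauses dismiss walks longer than 3.
    chord : ∀ {l₁ l₂ l₃ u a b v} → Chain l₁ u a → Chain l₂ a b → Chain l₃ b v → u ↦ v →
            l₁ ℕ.+ l₂ ℕ.+ l₃ ℕ.≤ 3 → a ≢ b → E a b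
    chord _ [] _ _ _ a≢b = ⊥-elim (a≢b refl)
    chord _ (e ∷ []) _ _ _ _ = proj₁ e
    chord [] (_ ∷ _ ∷ []) [] e _ _ = proj₁ e
    chord [] (e₁ ∷ e₂ ∷ []) (e₃ ∷ []) e _ _ = proj₁ (chords e₁ e₂ e₃ e)
    chord (e₁ ∷ []) (e₂ ∷ e₃ ∷ []) [] e _ _ = proj₂ (chords e₁ e₂ e₃ e)
    chord [] (_ ∷ _ ∷ _ ∷ []) [] e _ _ = proj₁ e
    chord [] (_ ∷ _ ∷ []) (_ ∷ _ ∷ _) _ (s≤s (s≤s (s≤s ()))) _
    chord [] (_ ∷ _ ∷ _ ∷ []) (_ ∷ _) _ (s≤s (s≤s (s≤s ()))) _
    chord [] (_ ∷ _ ∷ _ ∷ _ ∷ _) _ _ (s≤s (s≤s (s≤s ()))) _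
    chord (_ ∷ []) (_ ∷ _ ∷ []) (_ ∷ _) _ (s≤s (s≤s (s≤s ()))) _
    chord (_ ∷ []) (_ ∷ _ ∷ _ ∷ _) _ _ (s≤s (s≤s (s≤s ()))) _
    chord {suc (suc l₁)} {suc (suc l₂)} {l₃} (_ ∷ _ ∷ _) (_ ∷ _ ∷ _) _ _ total≤3 _ =
      ⊥-elim (ℕP.<-irrefl refl (ℕP.≤-trans four≤total total≤3))
      where
      four≤total : 4 ℕ.≤ suc (suc l₁) ℕ.+ suc (suc l₂) ℕ.+ l₃
      four≤total = ℕP.≤-trans (ℕP.+-mono-≤ (s≤s (s≤s z≤n)) (s≤s (s≤s z≤n))) (ℕP.m≤m+n _ l₃)

    within-arc : ∀ {u v x y} → u ↦ v → u ≼[ 0 ] x → y ≼[ 0 ] v → x ⇝ y → ∃[ n ] Chain n x y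
    within-arc arc ux yv (inj₁ far) with ≼-bound (≼-trans (≼-trans ux far) yv) (arc-short arc)
    ... | s≤s (s≤s (s≤s ()))
    within-arc _ _ _ (inj₂ (n , _ , ch)) = n , ch

    sandwich : ∀ {u v a b} → u ↦ v → u ⇝ a → a ⇝ b → b ⇝ v → a ≢ b → E a b
    sandwich arc ua ab bv a≢b =
      chord c₁ c₂ c₃ arc (≼-bound whole-walk (arc-short arc)) a≢b
      where
      c₁ = proj₂ (within-arc arc ≼-refl (≼-trans (⇝-rise ab) (⇝-rise bv)) ua)
      c₂ = proj₂ (within-arc arc (⇝-rise ua) (⇝-rise bv) ab)
      c₃ = proj₂ (within-arc arc (≼-trans (⇝-rise ua) (⇝-rise ab)) ≼-refl bv)
      whole-walk = ≼-trans (≼-trans (chain-rise c₁) (chain-rise c₂)) (chain-rise c₃)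

    -- The word: for every ordered pair (a, b) of vertices, four arrangements of L.
    -- `Anc a` are the vertices reaching a, `Desc b` the vertices reached from b.
    Anc Desc : A → DecSubset
    Anc a  = (λ z → z ⇝ a) , (λ z → z ⇝? a)
    Desc b = (b ⇝_) , (b ⇝?_)

    Separated : A → A → Set
    Separated a b = a ≢ b × ¬ E a b × a ⇝ b

    separated? : ∀ a b → Dec (Separated a b)
    separated? a b = ¬? (a ≟ b) ×-dec ¬? (E? a b) ×-dec a ⇝? b

    -- For separated a, b the blocks make a and b not alternate (a a b b); otherwise they
    -- list every vertex once with the ancestors of b first, then with the ancestors of a first.
    blocks : ∀ {a b} → Dec (Separated a b) → List DecSubset
    blocks {a} {b} (yes _) = complement (Desc b) ∷ Anc a ∷ Desc b ∷ complement (Anc a) ∷ []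
    blocks {a} {b} (no _)  = Anc b ∷ complement (Anc b) ∷ Anc a ∷ complement (Anc a) ∷ []

    build : List A → List A
    build zs = concatMap (λ a → concatMap (λ b → arrange (blocks (separated? a b)) zs) L) L

    W : List A
    W = build L

    filter-build : ∀ {Q : Pred A 0ℓ} (Q? : Decidable Q) zs → filter Q? (build zs) ≡ build (filter Q? zs)
    filter-build Q? zs =
      trans (filter-concatMap Q? _ L) (concatMap-cong (λ a →
        trans (filter-concatMap Q? _ L) (concatMap-cong (λ b → filter-arrange Q? (blocks (separated? a b)) zs) L)) L)

    ancestors-first : ∀ {u v x} → u ↦ v → (du : Dec (u ⇝ x)) (dv : Dec (v ⇝ x)) → ∀ rest →
                      keep₂ u v du dv ++ (keep₂ u v (¬? du) (¬? dv) ++ rest) ≡ u ∷ v ∷ rest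
    ancestors-first arc (yes _) (yes _) _ = refl
    ancestors-first arc (yes _) (no _) _ = refl
    ancestors-first arc (no ¬ux) (yes vx) _ = ⊥-elim (¬ux (⇝-arcˡ arc vx))
    ancestors-first arc (no _) (no _) _ = refl

    -- Along an arc u ↦ v, the blocks of a separated pair (a, b) list u v u v,
    -- since u ⇝ a and b ⇝ v cannot hold together.
    separated-arc : ∀ {u v a b} → u ↦ v → ¬ (u ⇝ a × b ⇝ v) →
                    (bu : Dec (b ⇝ u)) (bv : Dec (b ⇝ v)) (ua : Dec (u ⇝ a)) (va : Dec (v ⇝ a)) →
                    keep₂ u v (¬? bu) (¬? bv) ++
                      (keep₂ u v ua va ++ (keep₂ u v bu bv ++ (keep₂ u v (¬? ua) (¬? va) ++ [])))
                    ≡ u ∷ v ∷ u ∷ v ∷ []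
    separated-arc _ between _ (yes bv) (yes ua) _ = ⊥-elim (between (ua , bv))
    separated-arc arc _ (yes bu) (no ¬bv) _ _ = ⊥-elim (¬bv (⇝-arcʳ bu arc))
    separated-arc arc _ _ _ (no ¬ua) (yes va) = ⊥-elim (¬ua (⇝-arcˡ arc va))
    separated-arc _ _ (yes _) (yes _) (no _) (no _) = refl
    separated-arc _ _ (no _) (yes _) (no _) (no _) = refl
    separated-arc _ _ (no _) (no _) (yes _) (yes _) = refl
    separated-arc _ _ (no _) (no _) (yes _) (no _) = refl
    separated-arc _ _ (no _) (no _) (no _) (no _) = refl

    arc-blocks : ∀ {u v a b} → u ↦ v → (d : Dec (Separated a b)) →
                 arrange (blocks d) (u ∷ v ∷ []) ≡ u ∷ v ∷ u ∷ v ∷ []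
    arc-blocks {u} {v} {a} {b} arc (yes (a≢b , ¬ab , a⇝b)) =
      separated-arc arc (λ (ua , bv) → ¬ab (sandwich arc ua a⇝b bv a≢b)) (b ⇝? u) (b ⇝? v) (u ⇝? a) (v ⇝? a)
    arc-blocks {u} {v} {a} {b} arc (no _) =
      trans (ancestors-first arc (u ⇝? b) (v ⇝? b) _)
            (cong (λ rest → u ∷ v ∷ rest) (ancestors-first arc (u ⇝? a) (v ⇝? a) []))

    arc-ordered : ∀ {Q : Pred A 0ℓ} (Q? : Decidable Q) {u v} → u ↦ v →
                  filter Q? L ≡ u ∷ v ∷ [] ⊎ filter Q? L ≡ v ∷ u ∷ [] → filter Q? L ≡ u ∷ v ∷ []
    arc-ordered Q? _ (inj₁ uv) = uv
    arc-ordered Q? (_ , u≼v) (inj₂ vu) with subst (AllPairs _) vu (AllPairsP.filter⁺ Q? L-sorted)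
    ... | (κv≤κu ∷ []) ∷ _ = ⊥-elim (≼-below u≼v κv≤κu)

    arc-alternates : ∀ {Q : Pred A 0ℓ} (Q? : Decidable Q) {u v} → u ↦ v → filter Q? L ≡ u ∷ v ∷ [] →
                     Repeats u v (filter Q? W)
    arc-alternates Q? {u} {v} arc uv =
      subst (Repeats u v) (sym (trans (filter-build Q? L) (cong build uv)))
        (Repeats-concatMap _ L λ a → Repeats-concatMap _ L λ b →
          subst (Repeats u v) (sym (arc-blocks arc (separated? a b))) (uv∷ uv∷ []))

    edge-alternates : ∀ {x y} → x ∈ L → y ∈ L → x ≢ y → E x y → Alternate _≟_ W x y
    edge-alternates {x} {y} x∈ y∈ x≢y e = oriented (E-oriented e)
      where
      order = restrict-two x≢y x∈ y∈ L-unique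
      oriented : x ≼[ 1 ] y ⊎ y ≼[ 1 ] x → Alternate _≟_ W x y
      oriented (inj₁ x≼y) =
        Repeats⇒NoAdjEq x≢y (arc-alternates (pair? x y) (e , x≼y) (arc-ordered (pair? x y) (e , x≼y) order))
      oriented (inj₂ y≼x) =
        Repeats⇒NoAdjEq (x≢y ∘ sym)
          (arc-alternates (pair? x y) (E-sym e , y≼x) (arc-ordered (pair? x y) (E-sym e , y≼x) (Sum.swap order)))

    separated-pair : ∀ {x y zs} → Separated x y → zs ≡ x ∷ y ∷ [] ⊎ zs ≡ y ∷ x ∷ [] →
                     (d : Dec (Separated x y)) → ¬ NoAdjEq (arrange (blocks d) zs)
    separated-pair s _ (no ¬s) = ⊥-elim (¬s s)
    separated-pair {x} {y} {zs} (x≢y , _ , x⇝y) order (yes s) alternating =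
      proj₁ (subst NoAdjEq xx alternating) refl
      where
      ¬y⇝x : ¬ y ⇝ x
      ¬y⇝x y⇝x = x≢y (⇝-antisym x⇝y y⇝x)
      xx : arrange (blocks (yes s)) zs ≡ x ∷ x ∷ _
      xx = cong₂ _++_ (select-one (complement (Desc y)) order ¬y⇝x (λ ¬y⇝y → ¬y⇝y ⇝-refl))
                      (cong₂ _++_ (select-one (Anc x) order ⇝-refl ¬y⇝x) refl)

    unrelated-pair : ∀ {x y zs} → ¬ x ⇝ y → ¬ y ⇝ x → zs ≡ x ∷ y ∷ [] ⊎ zs ≡ y ∷ x ∷ [] →
                     (d : Dec (Separated x y)) → ¬ NoAdjEq (arrange (blocks d) zs)
    unrelated-pair ¬x⇝y _ _ (yes (_ , _ , x⇝y)) = ⊥-elim (¬x⇝y x⇝y)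
    unrelated-pair {x} {y} {zs} ¬x⇝y ¬y⇝x order (no ¬s) alternating =
      proj₁ (proj₂ (subst NoAdjEq yxx alternating)) refl
      where
      yxx : arrange (blocks (no ¬s)) zs ≡ y ∷ x ∷ x ∷ _
      yxx = cong₂ _++_ (select-one (Anc y) (Sum.swap order) ⇝-refl ¬x⇝y)
              (cong₂ _++_ (select-one (complement (Anc y)) order ¬x⇝y (λ ¬y⇝y → ¬y⇝y ⇝-refl))
                (cong₂ _++_ (select-one (Anc x) order ⇝-refl ¬y⇝x) refl))

    build-piece : ∀ {zs a b} → a ∈ L → b ∈ L → NoAdjEq (build zs) → NoAdjEq (arrange (blocks (separated? a b)) zs)
    build-piece {zs} {a} a∈ b∈ h =
      NoAdjEq-concatMap (λ b → arrange (blocks (separated? a b)) zs) b∈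
        (NoAdjEq-concatMap (λ a → concatMap (λ b → arrange (blocks (separated? a b)) zs) L) a∈ h)

    non-edge : ∀ {x y} → x ∈ L → y ∈ L → x ≢ y → ¬ E x y → ¬ Alternate _≟_ W x y
    non-edge {x} {y} x∈ y∈ x≢y ¬xy alternating = by-reachability (x ⇝? y) (y ⇝? x)
      where
      order = restrict-two x≢y x∈ y∈ L-unique
      piece : ∀ {a b} → a ∈ L → b ∈ L → NoAdjEq (arrange (blocks (separated? a b)) (filter (pair? x y) L))
      piece a∈ b∈ = build-piece {filter (pair? x y) L} a∈ b∈ (subst NoAdjEq (filter-build (pair? x y) L) alternating)
      by-reachability : Dec (x ⇝ y) → Dec (y ⇝ x) → ⊥
      by-reachability (yes x⇝y) _ = separated-pair (x≢y , ¬xy , x⇝y) order (separated? x y) (piece x∈ y∈)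
      by-reachability (no _) (yes y⇝x) =
        separated-pair (x≢y ∘ sym , ¬xy ∘ E-sym , y⇝x) (Sum.swap order) (separated? y x) (piece y∈ x∈)
      by-reachability (no ¬x⇝y) (no ¬y⇝x) = unrelated-pair ¬x⇝y ¬y⇝x order (separated? x y) (piece x∈ y∈)

    -- Every letter of W is a vertex, and every vertex x occurs in W (in the word of (x, x)).
    W⊆L : All (_∈ L) W
    W⊆L = All.tabulate λ z∈W →
      let (a , _ , z∈a)  = find (∈-concatMap⁻ (λ a → concatMap (λ b → arrange (blocks (separated? a b)) L) L)
                                             {xs = L} z∈W)
          (b , _ , z∈ab) = find (∈-concatMap⁻ (λ b → arrange (blocks (separated? a b)) L) {xs = L} z∈a)
      in arrange-⊆ (blocks (separated? a b)) z∈ab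

    L⊆W : ∀ {x} → x ∈ L → x ∈ W
    L⊆W {x} x∈ =
      ∈-concatMap⁺ (λ a → concatMap (λ b → arrange (blocks (separated? a b)) L) L)
        (lose x∈ (∈-concatMap⁺ (λ b → arrange (blocks (separated? x b)) L) (lose x∈ (own-word (separated? x x)))))
      where
      own-word : (d : Dec (Separated x x)) → x ∈ arrange (blocks d) L
      own-word (yes (x≢x , _)) = ⊥-elim (x≢x refl)
      own-word (no _) =
        ∈-++⁺ˡ (subst (x ∈_) (sym (select≡filter (Anc x) L)) (∈-filter⁺ (λ z → z ⇝? x) x∈ ⇝-refl))

    representable : WordRepresentable _≟_ (_∈ L) E
    representable =
      W , W⊆L , (λ _ → L⊆W) ,
      λ x y x∈ y∈ x≢y → mk⇔ (alternating⇒edge x∈ y∈ x≢y) (edge-alternates x∈ y∈ x≢y)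
      where
      alternating⇒edge : ∀ {x y} → x ∈ L → y ∈ L → x ≢ y → Alternate _≟_ W x y → E x y
      alternating⇒edge {x} {y} x∈ y∈ x≢y alternating with E? x y
      ... | yes xy = xy
      ... | no ¬xy = ⊥-elim (non-edge x∈ y∈ x≢y ¬xy alternating)

Dir : Set
Dir = Fin 4

pattern east  = Fin.zero
pattern west  = Fin.suc Fin.zero
pattern north = Fin.suc (Fin.suc Fin.zero)
pattern south = Fin.suc (Fin.suc (Fin.suc Fin.zero))

dx dy : Dir → ℤ
dx east  = + 1
dx west  = -[1+ 0 ]
dx north = + 0
dx south = + 0
dy east  = + 0
dy west  = + 0
dy north = + 1
dy south = -[1+ 0 ]

move : Dir → Point → Point
move east  (x , y) = x + + 1 , y
move west  (x , y) = x + -[1+ 0 ] , y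
move north (x , y) = x , y + + 1
move south (x , y) = x , y + -[1+ 0 ]

move-displacement : ∀ d x y → move d (x , y) ≡ (x + dx d , y + dy d)
move-displacement east  x y = cong (_ ,_) (sym (ℤP.+-identityʳ y))
move-displacement west  x y = cong (_ ,_) (sym (ℤP.+-identityʳ y))
move-displacement north x y = cong (_, _) (sym (ℤP.+-identityʳ x))
move-displacement south x y = cong (_, _) (sym (ℤP.+-identityʳ x))

opposite : Dir → Dir
opposite east  = west
opposite west  = east
opposite north = south
opposite south = north

move₂-displacement : ∀ d e x y → move e (move d (x , y)) ≡ (x + (dx d + dx e) , y + (dy d + dy e))
move₂-displacement d e x y = begin
  move e (move d (x , y))                     ≡⟨ cong (move e) (move-displacement d x y) ⟩
  move e (x + dx d , y + dy d)                ≡⟨ move-displacement e _ _ ⟩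
  (x + dx d + dx e , y + dy d + dy e)
    ≡⟨ cong₂ _,_ (ℤP.+-assoc x (dx d) (dx e)) (ℤP.+-assoc y (dy d) (dy e)) ⟩
  (x + (dx d + dx e) , y + (dy d + dy e))     ∎
  where open ≡-Reasoning

add-sub : ∀ a k → a + k + - k ≡ a
add-sub = solve-∀

move-opposite : ∀ d u → move (opposite d) (move d u) ≡ u
move-opposite east  (x , y) = cong (_, y) (add-sub x (+ 1))
move-opposite west  (x , y) = cong (_, y) (add-sub x -[1+ 0 ])
move-opposite north (x , y) = cong (x ,_) (add-sub y (+ 1))
move-opposite south (x , y) = cong (x ,_) (add-sub y -[1+ 0 ])

Step : Point → Point → Set
Step u v = ∃[ d ] v ≡ move d u

Step-sym : ∀ {u v} → Step u v → Step v u
Step-sym (d , refl) = opposite d , sym (move-opposite d _)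

side-step : ∀ {c u v} → Side c u v → Step u v
side-step (bottom i j) = east , refl
side-step (top i j)    = east , refl
side-step (lside i j)  = north , refl
side-step (rside i j)  = north , refl
side-step (flip s)     = Step-sym (side-step s)

oddℕ : ℕ → Bool
oddℕ zero    = false
oddℕ (suc n) = not (oddℕ n)

odd : ℤ → Bool
odd (+ n)    = oddℕ n
odd -[1+ n ] = not (oddℕ n)

odd-suc : ∀ z → odd (z + + 1) ≡ not (odd z)
odd-suc (+ n) = oddℕ-+1 n
  where
  oddℕ-+1 : ∀ n → oddℕ (n ℕ.+ 1) ≡ not (oddℕ n)
  oddℕ-+1 zero    = refl
  oddℕ-+1 (suc n) = cong not (oddℕ-+1 n)
odd-suc -[1+ zero ]  = refl
odd-suc -[1+ suc n ] = sym (not-involutive _)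

odd-pred : ∀ z → odd (z + -[1+ 0 ]) ≡ not (odd z)
odd-pred z = begin
  odd (z + -[1+ 0 ])                  ≡⟨ not-involutive _ ⟨
  not (not (odd (z + -[1+ 0 ])))      ≡⟨ cong not (odd-suc (z + -[1+ 0 ])) ⟨
  not (odd (z + -[1+ 0 ] + + 1))      ≡⟨ cong (not ∘ odd) (add-sub z -[1+ 0 ]) ⟩
  not (odd z)                         ∎
  where open ≡-Reasoning

parity : Point → Bool
parity (x , y) = odd (x + y)

parity-step : ∀ d u → parity (move d u) ≡ not (parity u)
parity-step east  (x , y) = trans (cong odd (shift x y)) (odd-suc (x + y))
  where shift : ∀ x y → x + + 1 + y ≡ x + y + + 1
        shift = solve-∀
parity-step west  (x , y) = trans (cong odd (shift x y)) (odd-pred (x + y))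
  where shift : ∀ x y → x + -[1+ 0 ] + y ≡ x + y + -[1+ 0 ]
        shift = solve-∀
parity-step north (x , y) = trans (cong odd (sym (ℤP.+-assoc x y (+ 1)))) (odd-suc (x + y))
parity-step south (x , y) = trans (cong odd (sym (ℤP.+-assoc x y -[1+ 0 ]))) (odd-pred (x + y))

bit : Bool → ℤ
bit true  = + 1
bit false = + 0

rise : Dir → Bool → ℤ
rise d o = (dx d + dx d) + (bit (not o) ℤ.- bit o)

opaque
  height : Point → ℤ
  height (x , y) = (x + x) + bit (parity (x , y))

  height-step : ∀ d u → height (move d u) ≡ height u + rise d (parity u)
  height-step d (x , y) = begin
    height (move d (x , y))                                   ≡⟨ cong height (move-displacement d x y) ⟩
    (x + dx d) + (x + dx d) + bit (parity (x + dx d , y + dy d)) ≡⟨ cong (λ p → (x + dx d) + (x + dx d) + bit p) flips ⟩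
    (x + dx d) + (x + dx d) + bit (not (parity (x , y)))      ≡⟨ regroup x (dx d) (bit (parity (x , y))) _ ⟩
    height (x , y) + rise d (parity (x , y))                  ∎
    where
    open ≡-Reasoning
    flips : parity (x + dx d , y + dy d) ≡ not (parity (x , y))
    flips = trans (cong parity (sym (move-displacement d x y))) (parity-step d (x , y))
    regroup : ∀ x a b b′ → (x + a) + (x + a) + b′ ≡ (x + x + b) + ((a + a) + (b′ ℤ.- b))
    regroup = solve-∀

rise-of-step : ∀ d o → rise d o ≡ + 1 ⊎ rise d o ≡ + 3 ⊎ rise d o ≡ -[1+ 0 ] ⊎ rise d o ≡ -[1+ 2 ]
rise-of-step east  true  = inj₁ refl
rise-of-step east  false = inj₂ (inj₁ refl)
rise-of-step west  true  = inj₂ (inj₂ (inj₂ refl))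
rise-of-step west  false = inj₂ (inj₂ (inj₁ refl))
rise-of-step north true  = inj₂ (inj₂ (inj₁ refl))
rise-of-step north false = inj₁ refl
rise-of-step south true  = inj₂ (inj₂ (inj₁ refl))
rise-of-step south false = inj₁ refl

-- Two different two-step paths d₁ d₂ and e₁ e₂ with the same (nonzero) displacement go around a
-- unit square; then the height changes by ±2.  Checked exhaustively over all directions.
SquareRise : Bool → Dir → Dir → Dir → Dir → Set
SquareRise o d₁ d₂ e₁ e₂ =
  d₂ ≢ opposite d₁ → e₁ ≢ d₁ → (dx d₁ + dx d₂ , dy d₁ + dy d₂) ≡ (dx e₁ + dx e₂ , dy e₁ + dy e₂) →
  rise d₁ o + rise d₂ (not o) ≡ + 2 ⊎ rise d₁ o + rise d₂ (not o) ≡ -[1+ 1 ]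

all-squares? : ∀ o → Dec (∀ d₁ d₂ e₁ e₂ → SquareRise o d₁ d₂ e₁ e₂)
all-squares? o = FinP.all? λ d₁ → FinP.all? λ d₂ → FinP.all? λ e₁ → FinP.all? λ e₂ →
  ¬? (d₂ Fin.≟ opposite d₁) →-dec ¬? (e₁ Fin.≟ d₁) →-dec (_ ≟P _) →-dec
    ((rise d₁ o + rise d₂ (not o)) ℤP.≟ + 2 ⊎-dec (rise d₁ o + rise d₂ (not o)) ℤP.≟ -[1+ 1 ])

square-rise : ∀ o d₁ d₂ e₁ e₂ → SquareRise o d₁ d₂ e₁ e₂
square-rise true  = from-yes (all-squares? true)
square-rise false = from-yes (all-squares? false)

Up : ℕ → Point → Point → Set
Up n u v = height v ≡ height u + + n

descent : ∀ {u v} n → height v ≡ height u + -[1+ n ] → Up (suc n) v u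
descent {u} n h = trans (sym (add-sub (height u) -[1+ n ])) (cong (_+ + suc n) (sym h))

square-height : ∀ {u a v b} → u ≢ v → a ≢ b → Step u a → Step a v → Step u b → Step b v →
                Up 2 u v ⊎ Up 2 v u
square-height {u} u≢v a≢b (d₁ , refl) (d₂ , refl) (e₁ , refl) (e₂ , same-end) =
  Sum.map (λ r≡2 → trans two-steps (cong (λ r → height u + r) r≡2))
          (λ r≡-2 → descent 1 (trans two-steps (cong (λ r → height u + r) r≡-2)))
          (square-rise (parity u) d₁ d₂ e₁ e₂ not-back not-along same-displacement)
  where
  not-back : d₂ ≢ opposite d₁
  not-back refl = u≢v (sym (move-opposite d₁ u))
  not-along : e₁ ≢ d₁
  not-along refl = a≢b refl
  same-displacement : (dx d₁ + dx d₂ , dy d₁ + dy d₂) ≡ (dx e₁ + dx e₂ , dy e₁ + dy e₂)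
  same-displacement =
    cong₂ _,_ (∙-cancelˡ (proj₁ u) _ _ (cong proj₁ ends)) (∙-cancelˡ (proj₂ u) _ _ (cong proj₂ ends))
    where ends = trans (sym (move₂-displacement d₁ d₂ _ _)) (trans same-end (move₂-displacement e₁ e₂ _ _))
  two-steps : height (move d₂ (move d₁ u)) ≡ height u + (rise d₁ (parity u) + rise d₂ (not (parity u)))
  two-steps = begin
    height (move d₂ (move d₁ u))                                       ≡⟨ height-step d₂ (move d₁ u) ⟩
    height (move d₁ u) + rise d₂ (parity (move d₁ u))
      ≡⟨ cong₂ _+_ (height-step d₁ u) (cong (rise d₂) (parity-step d₁ u)) ⟩
    height u + rise d₁ (parity u) + rise d₂ (not (parity u))           ≡⟨ ℤP.+-assoc (height u) _ _ ⟩
    height u + (rise d₁ (parity u) + rise d₂ (not (parity u)))         ∎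
    where open ≡-Reasoning

side-height : ∀ {u v} → Step u v → Up 1 u v ⊎ Up 3 u v ⊎ Up 1 v u ⊎ Up 3 v u
side-height {u} (d , refl) = classify (height-step d u) (rise-of-step d (parity u))
  where
  classify : ∀ {v r} → height v ≡ height u + r → r ≡ + 1 ⊎ r ≡ + 3 ⊎ r ≡ -[1+ 0 ] ⊎ r ≡ -[1+ 2 ] →
             Up 1 u v ⊎ Up 3 u v ⊎ Up 1 v u ⊎ Up 3 v u
  classify h (inj₁ refl)               = inj₁ h
  classify h (inj₂ (inj₁ refl))        = inj₂ (inj₁ h)
  classify h (inj₂ (inj₂ (inj₁ refl))) = inj₂ (inj₂ (inj₁ (descent 0 h)))
  classify h (inj₂ (inj₂ (inj₂ refl))) = inj₂ (inj₂ (inj₂ (descent 2 h)))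

corners : Cell → List Point
corners (i , j) = (i , j) ∷ (i + + 1 , j) ∷ (i , j + + 1) ∷ (i + + 1 , j + + 1) ∷ []

Corner⇒∈ : ∀ {c v} → Corner c v → v ∈ corners c
Corner⇒∈ (c00 i j) = here refl
Corner⇒∈ (c10 i j) = there (here refl)
Corner⇒∈ (c01 i j) = there (there (here refl))
Corner⇒∈ (c11 i j) = there (there (there (here refl)))

∈⇒Corner : ∀ {c v} → v ∈ corners c → Corner c v
∈⇒Corner {i , j} (here refl)                         = c00 i j
∈⇒Corner {i , j} (there (here refl))                 = c10 i j
∈⇒Corner {i , j} (there (there (here refl)))         = c01 i j
∈⇒Corner {i , j} (there (there (there (here refl)))) = c11 i j

sides : Cell → List (Point × Point)
sides (i , j) =
  ((i , j) , (i + + 1 , j)) ∷ ((i + + 1 , j) , (i , j)) ∷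
  ((i , j + + 1) , (i + + 1 , j + + 1)) ∷ ((i + + 1 , j + + 1) , (i , j + + 1)) ∷
  ((i , j) , (i , j + + 1)) ∷ ((i , j + + 1) , (i , j)) ∷
  ((i + + 1 , j) , (i + + 1 , j + + 1)) ∷ ((i + + 1 , j + + 1) , (i + + 1 , j)) ∷ []

∈⇒Side : ∀ {c u v} → (u , v) ∈ sides c → Side c u v
∈⇒Side {i , j} (here refl)                                                         = bottom i j
∈⇒Side {i , j} (there (here refl))                                                 = flip (bottom i j)
∈⇒Side {i , j} (there (there (here refl)))                                         = top i j
∈⇒Side {i , j} (there (there (there (here refl))))                                 = flip (top i j)
∈⇒Side {i , j} (there (there (there (there (here refl)))))                         = lside i j
∈⇒Side {i , j} (there (there (there (there (there (here refl))))))                 = flip (lside i j)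
∈⇒Side {i , j} (there (there (there (there (there (there (here refl)))))))         = rside i j
∈⇒Side {i , j} (there (there (there (there (there (there (there (here refl)))))))) = flip (rside i j)

Side⇒∈ : ∀ {c u v} → Side c u v → (u , v) ∈ sides c × (v , u) ∈ sides c
Side⇒∈ (bottom i j) = here refl , there (here refl)
Side⇒∈ (top i j)    = there (there (here refl)) , there (there (there (here refl)))
Side⇒∈ (lside i j)  = there (there (there (there (here refl)))) , there (there (there (there (there (here refl)))))
Side⇒∈ (rside i j)  = there (there (there (there (there (there (here refl)))))) ,
                      there (there (there (there (there (there (there (here refl)))))))
Side⇒∈ (flip s)     = Product.swap (Side⇒∈ s)

side-corners : ∀ {c u v} → Side c u v → Corner c u × Corner c v
side-corners (bottom i j) = c00 i j , c10 i j
side-corners (top i j)    = c01 i j , c11 i j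
side-corners (lside i j)  = c00 i j , c01 i j
side-corners (rside i j)  = c10 i j , c11 i j
side-corners (flip s)     = Product.swap (side-corners s)

module PolyominoGraph (P : Polyomino) where

  open Polyomino P using (cells)
  open Heights height

  Up⇒≼ : ∀ {n u v} → Up n u v → u ≼[ n ] v
  Up⇒≼ h = rises (ℤP.≤-reflexive (sym h))

  Up⇒≤ : ∀ {n m u v} → Up n u v → n ℕ.≤ m → height v ℤ.≤ height u + + m
  Up⇒≤ {u = u} h n≤m = ℤP.≤-trans (ℤP.≤-reflexive h) (ℤP.+-monoʳ-≤ (height u) (ℤ.+≤+ n≤m))

  side? : ∀ u v → Dec (PEdge P u v)
  side? u v = map′ found listed (any? (λ c → DecMembership._∈?_ (≡-dec _≟P_ _≟P_) (u , v) (sides c)) cells)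
    where
    found : Any (λ c → (u , v) ∈ sides c) cells → PEdge P u v
    found h = let (c , c∈ , uv∈) = find h in c , c∈ , ∈⇒Side uv∈
    listed : PEdge P u v → Any (λ c → (u , v) ∈ sides c) cells
    listed (c , c∈ , s) = lose c∈ (proj₁ (Side⇒∈ s))

  side-sym : ∀ {u v} → PEdge P u v → PEdge P v u
  side-sym (c , c∈ , s) = c , c∈ , flip s

  side-neighbours : ∀ {u v} → PEdge P u v → Step u v
  side-neighbours (_ , _ , s) = side-step s

  Diagonal : Point → Point → Set
  Diagonal u v = u ≢ v × ∃[ a ] ∃[ b ] (a ≢ b × PEdge P u a × PEdge P a v × PEdge P v b × PEdge P b u)

  neighbours : Point → List Point
  neighbours u = move east u ∷ move west u ∷ move north u ∷ move south u ∷ []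

  neighbour : ∀ {u v} → Step u v → v ∈ neighbours u
  neighbour (east  , refl) = here refl
  neighbour (west  , refl) = there (here refl)
  neighbour (north , refl) = there (there (here refl))
  neighbour (south , refl) = there (there (there (here refl)))

  -- The middle corners of a 4-cycle through u are neighbours of u, so diagonals are decidable.
  diagonal? : ∀ u v → Dec (Diagonal u v)
  diagonal? u v =
    ¬? (u ≟P v) ×-dec map′ found listed (any? (λ a → any? (λ b → cycle? a b) (neighbours u)) (neighbours u))
    where
    Cycle : Point → Point → Set
    Cycle a b = a ≢ b × PEdge P u a × PEdge P a v × PEdge P v b × PEdge P b u
    cycle? : ∀ a b → Dec (Cycle a b)
    cycle? a b = ¬? (a ≟P b) ×-dec side? u a ×-dec side? a v ×-dec side? v b ×-dec side? b u
    found : Any (λ a → Any (Cycle a) (neighbours u)) (neighbours u) → ∃[ a ] ∃[ b ] Cycle a b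
    found h = let (a , _ , h′) = find h ; (b , _ , cyc) = find h′ in a , b , cyc
    listed : ∃[ a ] ∃[ b ] Cycle a b → Any (λ a → Any (Cycle a) (neighbours u)) (neighbours u)
    listed (a , b , cyc@(_ , ua , _ , _ , bu)) =
      lose (neighbour (side-neighbours ua)) (lose (neighbour (side-neighbours (side-sym bu))) cyc)

  Edge : Point → Point → Set
  Edge = PK4Edge P

  edge? : ∀ u v → Dec (Edge u v)
  edge? u v = side? u v ⊎-dec diagonal? u v

  edge-sym : ∀ {u v} → Edge u v → Edge v u
  edge-sym (inj₁ s) = inj₁ (side-sym s)
  edge-sym (inj₂ (u≢v , a , b , a≢b , ua , av , vb , bu)) = inj₂ (u≢v ∘ sym , b , a , a≢b ∘ sym , vb , bu , ua , av)

  -- Heights along edges: diagonals rise by 2, hence every edge joins different heights.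
  diagonal-height : ∀ {u v} → Diagonal u v → Up 2 u v ⊎ Up 2 v u
  diagonal-height (u≢v , a , b , a≢b , ua , av , vb , bu) =
    square-height u≢v a≢b (side-neighbours ua) (side-neighbours av)
                          (side-neighbours (side-sym bu)) (side-neighbours (side-sym vb))

  edge-height : ∀ {u v} → Edge u v → u ≼[ 1 ] v ⊎ v ≼[ 1 ] u
  edge-height (inj₁ s) with side-height (side-neighbours s)
  ... | inj₁ h                = inj₁ (Up⇒≼ h)
  ... | inj₂ (inj₁ h)         = inj₁ (≼-weaken (s≤s z≤n) (Up⇒≼ h))
  ... | inj₂ (inj₂ (inj₁ h))  = inj₂ (Up⇒≼ h)
  ... | inj₂ (inj₂ (inj₂ h))  = inj₂ (≼-weaken (s≤s z≤n) (Up⇒≼ h))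
  edge-height (inj₂ d) = Sum.map (≼-weaken (s≤s z≤n) ∘ Up⇒≼) (≼-weaken (s≤s z≤n) ∘ Up⇒≼) (diagonal-height d)

  arc-short : ∀ {u v} → Arc Edge u v → height v ℤ.≤ height u + + 3
  arc-short (inj₁ s , u≼v) with side-height (side-neighbours s)
  ... | inj₁ h                = Up⇒≤ h (s≤s z≤n)
  ... | inj₂ (inj₁ h)         = Up⇒≤ h ℕP.≤-refl
  ... | inj₂ (inj₂ (inj₁ h))  = ⊥-elim (≼-asym u≼v (Up⇒≼ h))
  ... | inj₂ (inj₂ (inj₂ h))  = ⊥-elim (≼-asym u≼v (Up⇒≼ h))
  arc-short (inj₂ d , u≼v) with diagonal-height d
  ... | inj₁ h = Up⇒≤ h (s≤s (s≤s z≤n))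
  ... | inj₂ h = ⊥-elim (≼-asym u≼v (Up⇒≼ h))

  -- Diagonals rise by exactly 2, so an arc rising by less than 2, or by 3 or more, is a side.
  gentle-arc-is-side : ∀ {x y} → Arc Edge x y → ¬ x ≼[ 2 ] y → PEdge P x y
  gentle-arc-is-side (inj₁ s , _) _ = s
  gentle-arc-is-side (inj₂ d , x≼y) not-2 with diagonal-height d
  ... | inj₁ h = ⊥-elim (not-2 (Up⇒≼ h))
  ... | inj₂ h = ⊥-elim (≼-asym x≼y (Up⇒≼ h))

  steep-arc-is-side : ∀ {x y} → Edge x y → x ≼[ 3 ] y → PEdge P x y
  steep-arc-is-side (inj₁ s) _ = s
  steep-arc-is-side (inj₂ d) x≼y with diagonal-height d
  ... | inj₁ h with ≼-bound x≼y (Up⇒≤ h ℕP.≤-refl)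
  ...   | s≤s (s≤s ())
  steep-arc-is-side (inj₂ d) x≼y | inj₂ h = ⊥-elim (≼-asym x≼y (Up⇒≼ h))

  -- A directed path u ↦ p ↦ q ↦ v with a shortcut u ↦ v consists of unit rises around a unit
  -- square, so u, q and p, v are opposite corners of it.
  chords : ∀ {u p q v} → Arc Edge u p → Arc Edge p q → Arc Edge q v → Arc Edge u v → Edge u q × Edge p v
  chords {u} {p} {q} {v} (e₁ , u≼p) (e₂ , p≼q) (e₃ , q≼v) (e , u≼v) =
    inj₂ (u≢q , p , v , p≢v , s-up , s-pq , s-qv , side-sym s-uv) ,
    inj₂ (p≢v , q , u , u≢q ∘ sym , s-pq , s-qv , side-sym s-uv , s-up)
    where
    too-steep : ¬ u ≼[ 4 ] v
    too-steep u≼₄v with ≼-bound u≼₄v (arc-short (e , u≼v))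
    ... | s≤s (s≤s (s≤s ()))
    distinct : ∀ {a b} → a ≼[ 2 ] b → a ≢ b
    distinct a≼b refl = ≼-asym a≼b ≼-refl
    u≢q = distinct (≼-trans u≼p p≼q)
    p≢v = distinct (≼-trans p≼q q≼v)
    s-up = gentle-arc-is-side (e₁ , u≼p) (λ u≼₂p → too-steep (≼-trans u≼₂p (≼-trans p≼q q≼v)))
    s-pq = gentle-arc-is-side (e₂ , p≼q) (λ p≼₂q → too-steep (≼-trans u≼p (≼-trans p≼₂q q≼v)))
    s-qv = gentle-arc-is-side (e₃ , q≼v) (λ q≼₂v → too-steep (≼-trans (≼-trans u≼p p≼q) q≼₂v))
    s-uv = steep-arc-is-side e (≼-trans (≼-trans u≼p p≼q) q≼v)

  open SortBy height using (sort; sort-↭; sort-sorted)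

  all-corners : List Point
  all-corners = deduplicate _≟P_ (concatMap corners cells)

  vertices : List Point
  vertices = sort all-corners

  vertices-unique : Unique vertices
  vertices-unique = unique-↭ (↭-sym (sort-↭ all-corners)) (deduplicate-! _≟P_ (concatMap corners cells))

  vertex⇒∈ : ∀ {v} → PVertex P v → v ∈ vertices
  vertex⇒∈ (c , c∈ , corner) =
    ∈-resp-↭ (↭-sym (sort-↭ all-corners))
             (∈-deduplicate⁺ _≟P_ (∈-concatMap⁺ corners (lose c∈ (Corner⇒∈ corner))))

  ∈⇒vertex : ∀ {v} → v ∈ vertices → PVertex P v
  ∈⇒vertex v∈ =
    let v∈all = ∈-deduplicate⁻ _≟P_ _ (∈-resp-↭ (sort-↭ all-corners) v∈)
        (c , c∈ , v∈c) = find (∈-concatMap⁻ corners v∈all)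
    in c , c∈ , ∈⇒Corner v∈c

  edge⇒vertex : ∀ {u v} → Edge u v → u ∈ vertices
  edge⇒vertex (inj₁ (c , c∈ , s)) = vertex⇒∈ (c , c∈ , proj₁ (side-corners s))
  edge⇒vertex (inj₂ (_ , _ , _ , _ , (c , c∈ , s) , _)) = vertex⇒∈ (c , c∈ , proj₁ (side-corners s))

  open Representation _≟P_ vertices vertices-unique (sort-sorted all-corners)
                      Edge edge? edge-sym edge⇒vertex edge-height arc-short chords
    using (representable) public

theorem8 : (P : Polyomino) → WordRepresentable _≟P_ (PVertex P) (PK4Edge P)
theorem8 P = representable-resp _≟P_ ∈⇒vertex vertex⇒∈ representable
  where open PolyominoGraph P
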